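{- Let $n\geq 2$ and $v\geq 2$ be integers, and let $G$ be a weakly $(n,v)$-clique-partitioned graph. Then the number of edges of $G$ is at most \[\binom{nv}{2}-\frac{n(n-1)v}{2}.\]
   Context: A $v$-clique is a set of $v$ pairwise adjacent vertices. A graph $G$ of order $nv$ is weakly $(n,v)$-clique-partitioned if its vertex set can be decomposed in a unique way into $n$ vertex-disjoint $v$-cliques. Graphs are finite and simple. -}

module Defs where

open import Data.Nat using (ℕ; zero; suc; _+_; _*_; _∸_; _<_)
open import Data.Nat.Combinatorics using (_C_)
open import Data.Fin using (Fin; toℕ)
open import Data.List using (List; length; filter; allFin; concatMap; map)
open import Data.Product using (_×_; _,_; proj₁; proj₂; Σ)
open import Relation.Nullary using (¬_; Dec; _×-dec_)
open import Relation.Unary using (Decidable)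
open import Relation.Binary.PropositionalEquality using (_≡_)
open import Function.Bundles using (_⇔_)
open import Level using (0ℓ)

record Graph (N : ℕ) : Set₁ where
  field
    Adj     : Fin N → Fin N → Set
    adj?    : ∀ x y → Dec (Adj x y)
    sym     : ∀ {x y} → Adj x y → Adj y x
    irrefl  : ∀ {x} → ¬ Adj x x

open Graph public

count : ∀ {N} {P : Fin N → Set} → Decidable P → ℕ
count {N} P? = length (filter P? (allFin N))

numEdges : ∀ {N} → Graph N → ℕ
numEdges {N} G =
  length (filter (λ (p : Fin N × Fin N) → (proj₁ p Data.Fin.<? proj₂ p) ×-dec (adj? G (proj₁ p) (proj₂ p)))
          (concatMap (λ x → map (x ,_) (allFin N)) (allFin N)))

-- A decomposition of V(G) into n vertex-disjoint v-cliques, given as a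
-- labelling of vertices by blocks: every block has exactly v vertices and
-- any two distinct vertices in the same block are adjacent.
record CliquePartition {N : ℕ} (G : Graph N) (n v : ℕ) : Set where
  field
    block      : Fin N → Fin n
    blockSize  : ∀ (b : Fin n) → count (λ x → block x Data.Fin.≟ b) ≡ v
    blockClique : ∀ x y → block x ≡ block y → ¬ (x ≡ y) → Adj G x y

open CliquePartition public

-- Two decompositions are the same if they induce the same blocks (the
-- labelling of the blocks is irrelevant).
SameDecomposition : ∀ {N} {G : Graph N} {n v} → CliquePartition G n v → CliquePartition G n v → Set
SameDecomposition P Q = ∀ x y → (block P x ≡ block P y) ⇔ (block Q x ≡ block Q y)

WeaklyCliquePartitioned : (n v : ℕ) → Graph (n * v) → Set
WeaklyCliquePartitioned n v G =
  Σ (CliquePartition G n v) λ P → ∀ (Q : CliquePartition G n v) → SameDecomposition P Q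

-- Let x₀ lie in block i and y₀ in block j ≠ i. If x₀ is adjacent to all of
-- block j and y₀ to all of block i, exchanging x₀ and y₀ yields a second
-- decomposition into v-cliques, and it is a different one because x₀ leaves
-- the other v - 1 ≥ 1 vertices of block i behind. So under uniqueness, for
-- every pair of distinct blocks, every vertex of one of them has a
-- non-neighbour in the other, giving at least v non-edges between any two
-- blocks. Summing over the n(n-1) ordered pairs of blocks counts every
-- non-edge twice, so G misses at least n(n-1)v/2 of the C(nv,2) pairs.
module Submission where

open import Defs hiding (sym)
open import Data.Nat using (ℕ; zero; suc; _+_; _*_; _∸_; _≤_; _/_; z≤n; s≤s; s<s; s<s⁻¹)
open import Data.Nat.Properties hiding (_≟_; _<?_)
open import Data.Nat.Combinatorics using (_C_; nC1≡n; nCk+nC[k+1]≡[n+1]C[k+1])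
open import Data.Nat.DivMod using (m*n/n≡m; /-monoˡ-≤)
open import Data.Fin as F using (Fin; zero; suc; punchIn; _≟_; _<?_)
import Data.Fin.Properties as F
import Data.Fin.Permutation as Perm
import Data.Fin.Permutation.Components as PC
open import Data.List using (List; []; _∷_; _++_; length; filter; tabulate; concatMap; map)
open import Data.List.Properties using (filter-++; length-++; map-tabulate)
open import Data.Product using (_×_; _,_; proj₁; proj₂; ∃)
open import Data.Sum as Sum using (_⊎_; inj₁; inj₂; [_,_])
open import Data.Bool using (true; false)
open import Data.Empty using (⊥-elim)
open import Relation.Nullary using (¬_; Dec; yes; no; _because_; _×-dec_; _→-dec_; ¬?; decidable-stable; contradiction)
open import Relation.Nullary.Decidable using (toSum)
open import Relation.Unary using (Pred; Decidable)
open import Relation.Binary.Definitions using (tri<; tri≈; tri>)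
open import Relation.Binary.PropositionalEquality
  using (_≡_; _≢_; refl; trans; cong; cong₂; subst; module ≡-Reasoning) renaming (sym to ≡-sym)
open import Function using (_∘_; id)
open import Function.Bundles using (Equivalence)
open import Algebra.Properties.CommutativeSemigroup *-commutativeSemigroup using (x∙yz≈y∙xz)
open import Algebra.Properties.Semiring.Sum +-*-semiring
  using (sum-syntax; sum-cong-≗; sum-remove; ∑-distrib-+; ∑-comm; ∑-permute; *-distribˡ-sum; *-distribʳ-sum)

𝟙 : ∀ {p} {P : Set p} → Dec P → ℕ
𝟙 (true  because _) = 1
𝟙 (false because _) = 0

𝟙-mono : ∀ {p q} {P : Set p} {Q : Set q} (p? : Dec P) (q? : Dec Q) → (P → Q) → 𝟙 p? ≤ 𝟙 q?
𝟙-mono (yes _) (yes _) _   = ≤-refl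
𝟙-mono (yes p) (no ¬q) p→q = contradiction (p→q p) ¬q
𝟙-mono (no _)  _       _   = z≤n

𝟙-cong : ∀ {p q} {P : Set p} {Q : Set q} (p? : Dec P) (q? : Dec Q) → (P → Q) → (Q → P) → 𝟙 p? ≡ 𝟙 q?
𝟙-cong p? q? p→q q→p = ≤-antisym (𝟙-mono p? q? p→q) (𝟙-mono q? p? q→p)

𝟙-⊎ : ∀ {p q r} {P : Set p} {Q : Set q} {R : Set r} (r? : Dec R) (p? : Dec P) (q? : Dec Q) →
      ¬ (P × Q) → (R → P ⊎ Q) → (P ⊎ Q → R) → 𝟙 r? ≡ 𝟙 p? + 𝟙 q?
𝟙-⊎ _       (yes p) (yes q) disjoint _  _    = contradiction (p , q) disjoint
𝟙-⊎ (yes _) (yes _) (no _)  _        _  _    = refl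
𝟙-⊎ (yes _) (no _)  (yes _) _        _  _    = refl
𝟙-⊎ (yes r) (no ¬p) (no ¬q) _        to _    = contradiction (to r) [ ¬p , ¬q ]
𝟙-⊎ (no ¬r) (yes p) (no _)  _        _  from = contradiction (from (inj₁ p)) ¬r
𝟙-⊎ (no ¬r) (no _)  (yes q) _        _  from = contradiction (from (inj₂ q)) ¬r
𝟙-⊎ (no _)  (no _)  (no _)  _        _  _    = refl

𝟙-yes : ∀ {p} {P : Set p} (p? : Dec P) → P → 𝟙 p? ≡ 1
𝟙-yes (yes _) _ = refl
𝟙-yes (no ¬p) p = contradiction p ¬p

𝟙-no : ∀ {p} {P : Set p} (p? : Dec P) → ¬ P → 𝟙 p? ≡ 0
𝟙-no (yes p) ¬p = contradiction p ¬p
𝟙-no (no _)  _  = refl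

𝟙≤𝟙* : ∀ {p} {P : Set p} (p? : Dec P) {s : ℕ} → (P → 1 ≤ s) → 𝟙 p? ≤ 𝟙 p? * s
𝟙≤𝟙* (yes p) {s} 1≤s = ≤-trans (1≤s p) (≤-reflexive (≡-sym (+-identityʳ s)))
𝟙≤𝟙* (no _)      _   = z≤n

∑-cong : ∀ {m} {f g : Fin m → ℕ} → (∀ i → f i ≡ g i) → ∑[ i < m ] f i ≡ ∑[ i < m ] g i
∑-cong = sum-cong-≗

∑-mono : ∀ {m} {f g : Fin m → ℕ} → (∀ i → f i ≤ g i) → ∑[ i < m ] f i ≤ ∑[ i < m ] g i
∑-mono {zero}  _   = z≤n
∑-mono {suc m} f≤g = +-mono-≤ (f≤g zero) (∑-mono (f≤g ∘ suc))

∑-const : ∀ m (c : ℕ) → ∑[ i < m ] c ≡ m * c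
∑-const zero    _ = refl
∑-const (suc m) c = cong (c +_) (∑-const m c)

*≤∑ : ∀ {m c} (f : Fin m → ℕ) → (∀ i → c ≤ f i) → m * c ≤ ∑[ i < m ] f i
*≤∑ {zero}  _ _   = z≤n
*≤∑ {suc m} f c≤f = +-mono-≤ (c≤f zero) (*≤∑ (f ∘ suc) (c≤f ∘ suc))

summand≤∑ : ∀ {m} (f : Fin m → ℕ) (i : Fin m) → f i ≤ ∑[ k < m ] f k
summand≤∑ {suc m} f i = ≤-trans (m≤m+n (f i) _) (≤-reflexive (≡-sym (sum-remove {i = i} f)))

∑-𝟙-≟ : ∀ {m} (c : Fin m) → ∑[ i < m ] 𝟙 (c ≟ i) ≡ 1
∑-𝟙-≟ {suc m} c = begin
  ∑[ i < suc m ] 𝟙 (c ≟ i)                       ≡⟨ sum-remove {i = c} (λ i → 𝟙 (c ≟ i)) ⟩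
  𝟙 (c ≟ c) + ∑[ k < m ] 𝟙 (c ≟ punchIn c k)    ≡⟨ cong₂ _+_ (𝟙-yes (c ≟ c) refl) (∑-cong off-c) ⟩
  1 + ∑[ k < m ] 0                               ≡⟨ cong (1 +_) (trans (∑-const m 0) (*-zeroʳ m)) ⟩
  1                                              ∎
  where
  open ≡-Reasoning
  off-c : ∀ k → 𝟙 (c ≟ punchIn c k) ≡ 0
  off-c k = 𝟙-no (c ≟ punchIn c k) (F.punchInᵢ≢i c k ∘ ≡-sym)

∑-fibres : ∀ {N n} (b : Fin N → Fin n) (g : Fin N → ℕ) →
           ∑[ x < N ] g x ≡ ∑[ i < n ] ∑[ x < N ] (𝟙 (b x ≟ i) * g x)
∑-fibres {N} {n} b g = begin
  ∑[ x < N ] g x                                ≡⟨ ∑-cong (λ x → ≡-sym (one-fibre x)) ⟩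
  ∑[ x < N ] ((∑[ i < n ] 𝟙 (b x ≟ i)) * g x)   ≡⟨ ∑-cong (λ x → *-distribʳ-sum (g x) (λ i → 𝟙 (b x ≟ i))) ⟩
  ∑[ x < N ] ∑[ i < n ] (𝟙 (b x ≟ i) * g x)     ≡⟨ ∑-comm (λ x i → 𝟙 (b x ≟ i) * g x) ⟩
  ∑[ i < n ] ∑[ x < N ] (𝟙 (b x ≟ i) * g x)     ∎
  where
  open ≡-Reasoning
  one-fibre : ∀ x → (∑[ i < n ] 𝟙 (b x ≟ i)) * g x ≡ g x
  one-fibre x = trans (cong (_* g x) (∑-𝟙-≟ (b x))) (*-identityˡ (g x))

offDiagonal-≤-∑∑ : ∀ {n c} (e : Fin n → Fin n → ℕ) → (∀ i j → i ≢ j → c ≤ e i j) →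
                   n * (n ∸ 1) * c ≤ ∑[ i < n ] ∑[ j < n ] e i j
offDiagonal-≤-∑∑ {zero}      _ _     = z≤n
offDiagonal-≤-∑∑ {suc m} {c} e bound = begin
  suc m * m * c                        ≡⟨ *-assoc (suc m) m c ⟩
  suc m * (m * c)                      ≤⟨ *≤∑ _ row ⟩
  ∑[ i < suc m ] ∑[ j < suc m ] e i j  ∎
  where
  open ≤-Reasoning
  row : ∀ i → m * c ≤ ∑[ j < suc m ] e i j
  row i = begin
    m * c                                     ≤⟨ *≤∑ _ (λ k → bound i (punchIn i k) (F.punchInᵢ≢i i k ∘ ≡-sym)) ⟩
    ∑[ k < m ] e i (punchIn i k)              ≤⟨ m≤n+m _ (e i i) ⟩
    e i i + ∑[ k < m ] e i (punchIn i k)      ≡⟨ sum-remove {i = i} (e i) ⟨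
    ∑[ j < suc m ] e i j                      ∎

length-filter-tabulate : ∀ {a p} {A : Set a} {P : Pred A p} (P? : Decidable P) {m} (g : Fin m → A) →
                         length (filter P? (tabulate g)) ≡ ∑[ i < m ] 𝟙 (P? (g i))
length-filter-tabulate P? {zero}  g = refl
length-filter-tabulate P? {suc m} g with P? (g zero)
... | yes _ = cong suc (length-filter-tabulate P? (g ∘ suc))
... | no _  = length-filter-tabulate P? (g ∘ suc)

filter-concatMap : ∀ {a b p} {A : Set a} {B : Set b} {P : Pred B p} (P? : Decidable P) (k : A → List B) (xs : List A) →
                   filter P? (concatMap k xs) ≡ concatMap (filter P? ∘ k) xs
filter-concatMap P? k []       = refl
filter-concatMap P? k (x ∷ xs) =
  trans (filter-++ P? (k x) (concatMap k xs)) (cong (filter P? (k x) ++_) (filter-concatMap P? k xs))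

length-concatMap-tabulate : ∀ {a b} {A : Set a} {B : Set b} (k : A → List B) {m} (g : Fin m → A) →
                            length (concatMap k (tabulate g)) ≡ ∑[ i < m ] length (k (g i))
length-concatMap-tabulate k {zero}  g = refl
length-concatMap-tabulate k {suc m} g =
  trans (length-++ (k (g zero))) (cong (length (k (g zero)) +_) (length-concatMap-tabulate k (g ∘ suc)))

count≡∑ : ∀ {N} {P : Fin N → Set} (P? : Decidable P) → count P? ≡ ∑[ x < N ] 𝟙 (P? x)
count≡∑ P? = length-filter-tabulate P? id

numEdges≡∑∑ : ∀ {N} (G : Graph N) → numEdges G ≡ ∑[ x < N ] ∑[ y < N ] 𝟙 ((x <? y) ×-dec adj? G x y)
numEdges≡∑∑ {N} G = begin
  numEdges G                                              ≡⟨ cong length (filter-concatMap edge? row (tabulate id)) ⟩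
  length (concatMap (filter edge? ∘ row) (tabulate id))  ≡⟨ length-concatMap-tabulate (filter edge? ∘ row) id ⟩
  ∑[ x < N ] length (filter edge? (row x))               ≡⟨ ∑-cong count-row ⟩
  ∑[ x < N ] ∑[ y < N ] 𝟙 ((x <? y) ×-dec adj? G x y)    ∎
  where
  open ≡-Reasoning
  edge? : Decidable (λ (p : Fin N × Fin N) → (proj₁ p F.< proj₂ p) × Adj G (proj₁ p) (proj₂ p))
  edge? (x , y) = (x <? y) ×-dec adj? G x y
  row : Fin N → List (Fin N × Fin N)
  row x = map (x ,_) (tabulate id)
  count-row : ∀ x → length (filter edge? (row x)) ≡ ∑[ y < N ] 𝟙 ((x <? y) ×-dec adj? G x y)
  count-row x = trans (cong (length ∘ filter edge?) (map-tabulate id (x ,_))) (length-filter-tabulate edge? (x ,_))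

pairs-count : ∀ N → ∑[ x < N ] ∑[ y < N ] 𝟙 (x <? y) ≡ N C 2
pairs-count zero    = refl
pairs-count (suc m) = begin
  ∑[ y < suc m ] 𝟙 (zero {m} <? y) + ∑[ x < m ] ∑[ y < suc m ] 𝟙 (suc x <? y)
    ≡⟨ cong₂ _+_ first-row (∑-cong {m} later-row) ⟩
  m + ∑[ x < m ] ∑[ y < m ] 𝟙 (x <? y)
    ≡⟨ cong₂ _+_ (≡-sym (nC1≡n m)) (pairs-count m) ⟩
  m C 1 + m C 2
    ≡⟨ nCk+nC[k+1]≡[n+1]C[k+1] m 1 ⟩
  suc m C 2 ∎
  where
  open ≡-Reasoning
  first-row : ∑[ y < suc m ] 𝟙 (zero {m} <? y) ≡ m
  first-row = cong₂ _+_ (𝟙-no (zero {m} <? zero {m}) λ ())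
    (trans (∑-cong {m} λ y → 𝟙-yes (zero {m} <? suc y) (s≤s z≤n)) (trans (∑-const m 1) (*-identityʳ m)))
  later-row : ∀ x → ∑[ y < suc m ] 𝟙 (suc x <? y) ≡ ∑[ y < m ] 𝟙 (x <? y)
  later-row x = cong₂ _+_ (𝟙-no (suc x <? zero {m}) λ ())
    (∑-cong {m} λ y → 𝟙-cong (suc x <? suc y) (x <? y) s<s⁻¹ s<s)

module _ {N} {R : Fin N → Fin N → Set} (R? : ∀ x y → Dec (R x y)) where

  private
    related unrelated : Fin N → Fin N → ℕ
    related   x y = 𝟙 ((x <? y) ×-dec R? x y)
    unrelated x y = 𝟙 ((x <? y) ×-dec ¬? (R? x y))

  pairs-split : ∑[ x < N ] ∑[ y < N ] 𝟙 ((x <? y) ×-dec R? x y)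
                + ∑[ x < N ] ∑[ y < N ] 𝟙 ((x <? y) ×-dec ¬? (R? x y))
                ≡ N C 2
  pairs-split = begin
    ∑[ x < N ] ∑[ y < N ] related x y + ∑[ x < N ] ∑[ y < N ] unrelated x y
      ≡⟨ ∑-distrib-+ (λ x → ∑[ y < N ] related x y) (λ x → ∑[ y < N ] unrelated x y) ⟨
    ∑[ x < N ] (∑[ y < N ] related x y + ∑[ y < N ] unrelated x y)
      ≡⟨ ∑-cong (λ x → ∑-distrib-+ (related x) (unrelated x)) ⟨
    ∑[ x < N ] ∑[ y < N ] (related x y + unrelated x y)
      ≡⟨ ∑-cong (λ x → ∑-cong λ y → ≡-sym (split x y)) ⟩
    ∑[ x < N ] ∑[ y < N ] 𝟙 (x <? y)
      ≡⟨ pairs-count N ⟩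
    N C 2 ∎
    where
    open ≡-Reasoning
    split : ∀ x y → 𝟙 (x <? y) ≡ related x y + unrelated x y
    split x y = 𝟙-⊎ (x <? y) ((x <? y) ×-dec R? x y) ((x <? y) ×-dec ¬? (R? x y))
      (λ ((_ , r) , (_ , ¬r)) → ¬r r)
      (λ x<y → Sum.map (x<y ,_) (x<y ,_) (toSum (R? x y)))
      [ proj₁ , proj₁ ]

  ordered-pairs : (∀ {x y} → R x y → R y x) →
                  ∑[ x < N ] ∑[ y < N ] 𝟙 (¬? (x ≟ y) ×-dec R? x y)
                  ≡ 2 * ∑[ x < N ] ∑[ y < N ] 𝟙 ((x <? y) ×-dec R? x y)
  ordered-pairs R-sym = begin
    ∑[ x < N ] ∑[ y < N ] 𝟙 (¬? (x ≟ y) ×-dec R? x y)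
      ≡⟨ ∑-cong (λ x → ∑-cong (split x)) ⟩
    ∑[ x < N ] ∑[ y < N ] (related x y + related y x)
      ≡⟨ ∑-cong (λ x → ∑-distrib-+ (related x) (λ y → related y x)) ⟩
    ∑[ x < N ] (∑[ y < N ] related x y + ∑[ y < N ] related y x)
      ≡⟨ ∑-distrib-+ (λ x → ∑[ y < N ] related x y) (λ x → ∑[ y < N ] related y x) ⟩
    U + ∑[ x < N ] ∑[ y < N ] related y x
      ≡⟨ cong (U +_) (∑-comm (λ x y → related y x)) ⟩
    U + U
      ≡⟨ cong (U +_) (+-identityʳ U) ⟨
    2 * U ∎
    where
    open ≡-Reasoning
    U = ∑[ x < N ] ∑[ y < N ] related x y
    split : ∀ x y → 𝟙 (¬? (x ≟ y) ×-dec R? x y) ≡ related x y + related y x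
    split x y = 𝟙-⊎ (¬? (x ≟ y) ×-dec R? x y) ((x <? y) ×-dec R? x y) ((y <? x) ×-dec R? y x)
      (λ ((x<y , _) , (y<x , _)) → F.<-asym x<y y<x)
      (λ (x≢y , r) → Sum.map (_, r) (_, R-sym r) (compare x≢y))
      [ (λ (x<y , r) → F.<⇒≢ x<y , r) , (λ (y<x , r) → F.<⇒≢ y<x ∘ ≡-sym , R-sym r) ]
      where
      compare : x ≢ y → x F.< y ⊎ y F.< x
      compare x≢y with F.<-cmp x y
      ... | tri< x<y _ _ = inj₁ x<y
      ... | tri≈ _ x≡y _ = contradiction x≡y x≢y
      ... | tri> _ _ y<x = inj₂ y<x

transpose-cases : ∀ {m} (i j k : Fin m) →
                  (k ≡ i × PC.transpose i j k ≡ j) ⊎ (k ≡ j × PC.transpose i j k ≡ i)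
                  ⊎ (k ≢ i × k ≢ j × PC.transpose i j k ≡ k)
transpose-cases i j k with k ≟ i
... | yes k≡i = inj₁ (k≡i , refl)
... | no k≢i with k ≟ j
...   | yes k≡j = inj₂ (inj₁ (k≡j , refl))
...   | no k≢j  = inj₂ (inj₂ (k≢i , k≢j , refl))

transpose-matchˡ : ∀ {m} (i j : Fin m) → PC.transpose i j i ≡ j
transpose-matchˡ i j with transpose-cases i j i
... | inj₁ (_ , τi≡j)          = τi≡j
... | inj₂ (inj₁ (i≡j , τi≡i)) = trans τi≡i i≡j
... | inj₂ (inj₂ (i≢i , _ , _)) = contradiction refl i≢i

NonEdge : ∀ {N} → Graph N → Fin N → Fin N → Set
NonEdge G x y = x ≢ y × ¬ Adj G x y

nonEdge? : ∀ {N} (G : Graph N) x y → Dec (NonEdge G x y)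
nonEdge? G x y = ¬? (x ≟ y) ×-dec ¬? (adj? G x y)

module _ {N n v} {G : Graph N} (P : CliquePartition G n v) where

  private
    b = block P

  ∑-block : ∀ i → ∑[ x < N ] 𝟙 (b x ≟ i) ≡ v
  ∑-block i = trans (≡-sym (count≡∑ (λ x → b x ≟ i))) (blockSize P i)

  ∃-sameBlock-≢ : 2 ≤ v → ∀ x → ∃ λ w → b w ≡ b x × w ≢ x
  ∃-sameBlock-≢ 2≤v x with F.any? (λ w → (b w ≟ b x) ×-dec ¬? (w ≟ x))
  ... | yes found = found
  ... | no none   = contradiction 2≤1 λ { (s≤s ()) }
    where
    open ≤-Reasoning
    only-x : ∀ w → b w ≡ b x → x ≡ w
    only-x w bw≡bx = ≡-sym (decidable-stable (w ≟ x) λ w≢x → none (w , bw≡bx , w≢x))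
    2≤1 : 2 ≤ 1
    2≤1 = begin
      2                          ≤⟨ 2≤v ⟩
      v                          ≡⟨ ∑-block (b x) ⟨
      ∑[ w < N ] 𝟙 (b w ≟ b x)   ≤⟨ ∑-mono (λ w → 𝟙-mono (b w ≟ b x) (x ≟ w) (only-x w)) ⟩
      ∑[ w < N ] 𝟙 (x ≟ w)       ≡⟨ ∑-𝟙-≟ x ⟩
      1                          ∎

  CompleteTo : Fin N → Fin n → Set
  CompleteTo x i = ∀ z → b z ≡ i → Adj G x z

  HasNonNeighbourIn : Fin n → Fin n → Set
  HasNonNeighbourIn i j = ∀ x → b x ≡ i → ∃ λ y → b y ≡ j × ¬ Adj G x y

  private
    nonNeighbourIn? : ∀ i j x → Dec (b x ≡ i → ∃ λ y → b y ≡ j × ¬ Adj G x y)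
    nonNeighbourIn? i j x = (b x ≟ i) →-dec F.any? λ y → (b y ≟ j) ×-dec ¬? (adj? G x y)

  hasNonNeighbourIn? : ∀ i j → Dec (HasNonNeighbourIn i j)
  hasNonNeighbourIn? i j = F.all? (nonNeighbourIn? i j)

  ¬hasNonNeighbourIn⇒∃complete : ∀ {i j} → ¬ HasNonNeighbourIn i j → ∃ λ x → b x ≡ i × CompleteTo x j
  ¬hasNonNeighbourIn⇒∃complete {i} {j} ¬all with F.¬∀⟶∃¬ N _ (nonNeighbourIn? i j) ¬all
  ... | x , ¬nonNeighbour = x , bx≡i , complete
    where
    bx≡i : b x ≡ i
    bx≡i = decidable-stable (b x ≟ i) λ bx≢i → ¬nonNeighbour λ bx≡i → contradiction bx≡i bx≢i
    complete : CompleteTo x j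
    complete z bz≡j = decidable-stable (adj? G x z) λ ¬adj → ¬nonNeighbour λ _ → z , bz≡j , ¬adj

  crossNonEdges : Fin n → Fin n → ℕ
  crossNonEdges i j = ∑[ x < N ] (𝟙 (b x ≟ i) * ∑[ y < N ] (𝟙 (b y ≟ j) * 𝟙 (nonEdge? G x y)))

  ∑∑-nonEdge≡∑∑-crossNonEdges :
    ∑[ x < N ] ∑[ y < N ] 𝟙 (nonEdge? G x y) ≡ ∑[ i < n ] ∑[ j < n ] crossNonEdges i j
  ∑∑-nonEdge≡∑∑-crossNonEdges = begin
    ∑[ x < N ] ∑[ y < N ] h x y
      ≡⟨ ∑-fibres b (λ x → ∑[ y < N ] h x y) ⟩
    ∑[ i < n ] ∑[ x < N ] (𝟙 (b x ≟ i) * ∑[ y < N ] h x y)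
      ≡⟨ ∑-cong (λ i → ∑-cong λ x → cong (𝟙 (b x ≟ i) *_) (∑-fibres b (h x))) ⟩
    ∑[ i < n ] ∑[ x < N ] (𝟙 (b x ≟ i) * ∑[ j < n ] ∑[ y < N ] (𝟙 (b y ≟ j) * h x y))
      ≡⟨ ∑-cong (λ i → ∑-cong λ x → *-distribˡ-sum (𝟙 (b x ≟ i)) (λ j → ∑[ y < N ] (𝟙 (b y ≟ j) * h x y))) ⟩
    ∑[ i < n ] ∑[ x < N ] ∑[ j < n ] (𝟙 (b x ≟ i) * ∑[ y < N ] (𝟙 (b y ≟ j) * h x y))
      ≡⟨ ∑-cong (λ i → ∑-comm (λ x j → 𝟙 (b x ≟ i) * ∑[ y < N ] (𝟙 (b y ≟ j) * h x y))) ⟩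
    ∑[ i < n ] ∑[ j < n ] crossNonEdges i j ∎
    where
    open ≡-Reasoning
    h : Fin N → Fin N → ℕ
    h x y = 𝟙 (nonEdge? G x y)

  crossNonEdges-comm : ∀ i j → crossNonEdges i j ≡ crossNonEdges j i
  crossNonEdges-comm i j = begin
    crossNonEdges i j                  ≡⟨ expand i j ⟩
    ∑[ x < N ] ∑[ y < N ] t i j x y    ≡⟨ ∑-comm (t i j) ⟩
    ∑[ y < N ] ∑[ x < N ] t i j x y    ≡⟨ ∑-cong (λ y → ∑-cong λ x → t-comm x y) ⟩
    ∑[ y < N ] ∑[ x < N ] t j i y x    ≡⟨ expand j i ⟨
    crossNonEdges j i                  ∎
    where
    open ≡-Reasoning
    t : Fin n → Fin n → Fin N → Fin N → ℕ
    t i j x y = 𝟙 (b x ≟ i) * (𝟙 (b y ≟ j) * 𝟙 (nonEdge? G x y))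
    expand : ∀ i j → crossNonEdges i j ≡ ∑[ x < N ] ∑[ y < N ] t i j x y
    expand i j = ∑-cong λ x → *-distribˡ-sum (𝟙 (b x ≟ i)) (λ y → 𝟙 (b y ≟ j) * 𝟙 (nonEdge? G x y))
    nonEdge-sym : ∀ {x y} → NonEdge G x y → NonEdge G y x
    nonEdge-sym (x≢y , ¬adj) = x≢y ∘ ≡-sym , ¬adj ∘ Graph.sym G
    t-comm : ∀ x y → t i j x y ≡ t j i y x
    t-comm x y = trans (x∙yz≈y∙xz (𝟙 (b x ≟ i)) (𝟙 (b y ≟ j)) _)
      (cong (λ k → 𝟙 (b y ≟ j) * (𝟙 (b x ≟ i) * k)) (𝟙-cong (nonEdge? G x y) (nonEdge? G y x) nonEdge-sym nonEdge-sym))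

  hasNonNeighbourIn⇒v≤crossNonEdges : ∀ {i j} → i ≢ j → HasNonNeighbourIn i j → v ≤ crossNonEdges i j
  hasNonNeighbourIn⇒v≤crossNonEdges {i} {j} i≢j nonNeighbour = begin
    v                           ≡⟨ ∑-block i ⟨
    ∑[ x < N ] 𝟙 (b x ≟ i)      ≤⟨ ∑-mono (λ x → 𝟙≤𝟙* (b x ≟ i) (positive x)) ⟩
    crossNonEdges i j           ∎
    where
    open ≤-Reasoning
    positive : ∀ x → b x ≡ i → 1 ≤ ∑[ y < N ] (𝟙 (b y ≟ j) * 𝟙 (nonEdge? G x y))
    positive x bx≡i with nonNeighbour x bx≡i
    ... | y , by≡j , ¬adj = ≤-trans
      (≤-reflexive (≡-sym (cong₂ _*_ (𝟙-yes (b y ≟ j) by≡j) (𝟙-yes (nonEdge? G x y) (x≢y , ¬adj)))))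
      (summand≤∑ (λ y → 𝟙 (b y ≟ j) * 𝟙 (nonEdge? G x y)) y)
      where
      x≢y : x ≢ y
      x≢y refl = i≢j (trans (≡-sym bx≡i) by≡j)

module Swap {N n v} {G : Graph N} (P : CliquePartition G n v) (x₀ y₀ : Fin N)
            (x₀-complete : CompleteTo P x₀ (block P y₀)) (y₀-complete : CompleteTo P y₀ (block P x₀)) where

  private
    b = block P
    τ = PC.transpose x₀ y₀

  blocks-differ : b x₀ ≢ b y₀
  blocks-differ bx₀≡by₀ = irrefl G (x₀-complete x₀ bx₀≡by₀)

  τx₀≡y₀ : τ x₀ ≡ y₀
  τx₀≡y₀ = transpose-matchˡ x₀ y₀

  τy₀≡x₀ : τ y₀ ≡ x₀
  τy₀≡x₀ with transpose-cases x₀ y₀ y₀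
  ... | inj₁ (y₀≡x₀ , _)            = contradiction (cong b (≡-sym y₀≡x₀)) blocks-differ
  ... | inj₂ (inj₁ (_ , τy₀≡x₀))    = τy₀≡x₀
  ... | inj₂ (inj₂ (_ , y₀≢y₀ , _)) = contradiction refl y₀≢y₀

  relabel : ∀ {u u′ w w′} → b u ≡ b w → u ≡ u′ → w ≡ w′ → b u′ ≡ b w′
  relabel same refl refl = same

  x₀-adj : ∀ y → x₀ ≢ y → b (τ x₀) ≡ b (τ y) → Adj G x₀ y
  x₀-adj y x₀≢y same with transpose-cases x₀ y₀ y
  ... | inj₁ (y≡x₀ , _)           = contradiction (≡-sym y≡x₀) x₀≢y
  ... | inj₂ (inj₁ (_ , τy≡x₀))    = contradiction (≡-sym (relabel same τx₀≡y₀ τy≡x₀)) blocks-differ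
  ... | inj₂ (inj₂ (_ , _ , τy≡y)) = x₀-complete y (≡-sym (relabel same τx₀≡y₀ τy≡y))

  y₀-adj : ∀ y → y₀ ≢ y → b (τ y₀) ≡ b (τ y) → Adj G y₀ y
  y₀-adj y y₀≢y same with transpose-cases x₀ y₀ y
  ... | inj₁ (_ , τy≡y₀)           = contradiction (relabel same τy₀≡x₀ τy≡y₀) blocks-differ
  ... | inj₂ (inj₁ (y≡y₀ , _))     = contradiction (≡-sym y≡y₀) y₀≢y
  ... | inj₂ (inj₂ (_ , _ , τy≡y)) = y₀-complete y (≡-sym (relabel same τy₀≡x₀ τy≡y))

  swapped-clique : ∀ x y → b (τ x) ≡ b (τ y) → x ≢ y → Adj G x y
  swapped-clique x y same x≢y with transpose-cases x₀ y₀ x | transpose-cases x₀ y₀ y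
  ... | inj₁ (refl , _)            | _                      = x₀-adj y x≢y same
  ... | inj₂ (inj₁ (refl , _))     | _                      = y₀-adj y x≢y same
  ... | inj₂ (inj₂ _)              | inj₁ (refl , _)        = Graph.sym G (x₀-adj x (x≢y ∘ ≡-sym) (≡-sym same))
  ... | inj₂ (inj₂ _)              | inj₂ (inj₁ (refl , _)) = Graph.sym G (y₀-adj x (x≢y ∘ ≡-sym) (≡-sym same))
  ... | inj₂ (inj₂ (_ , _ , τx≡x)) | inj₂ (inj₂ (_ , _ , τy≡y)) =
    blockClique P x y (relabel same τx≡x τy≡y) x≢y

  swapped-size : ∀ i → count (λ x → b (τ x) ≟ i) ≡ v
  swapped-size i = begin
    count (λ x → b (τ x) ≟ i)      ≡⟨ count≡∑ (λ x → b (τ x) ≟ i) ⟩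
    ∑[ x < N ] 𝟙 (b (τ x) ≟ i)     ≡⟨ ∑-permute (λ x → 𝟙 (b x ≟ i)) (Perm.transpose x₀ y₀) ⟨
    ∑[ x < N ] 𝟙 (b x ≟ i)         ≡⟨ ∑-block P i ⟩
    v                              ∎
    where open ≡-Reasoning

  swapped : CliquePartition G n v
  swapped = record { block = b ∘ τ ; blockSize = swapped-size ; blockClique = swapped-clique }

  swapped-differs : 2 ≤ v → ¬ SameDecomposition P swapped
  swapped-differs 2≤v same with ∃-sameBlock-≢ P 2≤v x₀
  ... | w , bw≡bx₀ , w≢x₀ with transpose-cases x₀ y₀ w
  ...   | inj₁ (w≡x₀ , _)            = w≢x₀ w≡x₀
  ...   | inj₂ (inj₁ (w≡y₀ , _))     = blocks-differ (trans (≡-sym bw≡bx₀) (cong b w≡y₀))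
  ...   | inj₂ (inj₂ (_ , _ , τw≡w)) =
    blocks-differ (≡-sym (trans (relabel (Equivalence.to (same x₀ w) (≡-sym bw≡bx₀)) τx₀≡y₀ τw≡w) bw≡bx₀))

module _ {N n v} {G : Graph N} (P : CliquePartition G n v) (2≤v : 2 ≤ v)
         (unique : ∀ Q → SameDecomposition P Q) where

  unique⇒¬mutuallyComplete : ∀ x y → CompleteTo P x (block P y) → ¬ CompleteTo P y (block P x)
  unique⇒¬mutuallyComplete x y x-complete y-complete =
    Swap.swapped-differs P x y x-complete y-complete 2≤v (unique (Swap.swapped P x y x-complete y-complete))

  unique⇒hasNonNeighbourIn : ∀ i j → HasNonNeighbourIn P i j ⊎ HasNonNeighbourIn P j i
  unique⇒hasNonNeighbourIn i j with hasNonNeighbourIn? P i j | hasNonNeighbourIn? P j i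
  ... | yes nonNeighbour | _                = inj₁ nonNeighbour
  ... | no _             | yes nonNeighbour = inj₂ nonNeighbour
  ... | no ¬ij           | no ¬ji
    with ¬hasNonNeighbourIn⇒∃complete P ¬ij | ¬hasNonNeighbourIn⇒∃complete P ¬ji
  ...   | x , bx≡i , x-complete | y , by≡j , y-complete =
    ⊥-elim (unique⇒¬mutuallyComplete x y
      (subst (CompleteTo P x) (≡-sym by≡j) x-complete) (subst (CompleteTo P y) (≡-sym bx≡i) y-complete))

  unique⇒v≤crossNonEdges : ∀ i j → i ≢ j → v ≤ crossNonEdges P i j
  unique⇒v≤crossNonEdges i j i≢j with unique⇒hasNonNeighbourIn i j
  ... | inj₁ nonNeighbour = hasNonNeighbourIn⇒v≤crossNonEdges P i≢j nonNeighbour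
  ... | inj₂ nonNeighbour = ≤-trans (hasNonNeighbourIn⇒v≤crossNonEdges P (i≢j ∘ ≡-sym) nonNeighbour)
                                    (≤-reflexive (crossNonEdges-comm P j i))

lemma3p1 : (n v : ℕ) → 2 ≤ n → 2 ≤ v → (G : Graph (n * v)) → WeaklyCliquePartitioned n v G →
    numEdges G ≤ ((n * v) C 2) ∸ ((n * (n ∸ 1) * v) / 2)
lemma3p1 n v _ 2≤v G (P , unique) = m+n≤o⇒m≤o∸n (numEdges G) (begin
  numEdges G + n * (n ∸ 1) * v / 2  ≤⟨ +-mono-≤ (≤-reflexive (numEdges≡∑∑ G)) bound/2 ⟩
  edges + nonEdges                   ≡⟨ pairs-split (adj? G) ⟩
  (n * v) C 2                        ∎)
  where
  open ≤-Reasoning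
  edges nonEdges : ℕ
  edges    = ∑[ x < n * v ] ∑[ y < n * v ] 𝟙 ((x <? y) ×-dec adj? G x y)
  nonEdges = ∑[ x < n * v ] ∑[ y < n * v ] 𝟙 ((x <? y) ×-dec ¬? (adj? G x y))
  bound : n * (n ∸ 1) * v ≤ 2 * nonEdges
  bound = begin
    n * (n ∸ 1) * v
      ≤⟨ offDiagonal-≤-∑∑ (crossNonEdges P) (unique⇒v≤crossNonEdges P 2≤v unique) ⟩
    ∑[ i < n ] ∑[ j < n ] crossNonEdges P i j
      ≡⟨ ∑∑-nonEdge≡∑∑-crossNonEdges P ⟨
    ∑[ x < n * v ] ∑[ y < n * v ] 𝟙 (nonEdge? G x y)
      ≡⟨ ordered-pairs (λ x y → ¬? (adj? G x y)) (λ ¬adj → ¬adj ∘ Graph.sym G) ⟩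
    2 * nonEdges ∎
  bound/2 : n * (n ∸ 1) * v / 2 ≤ nonEdges
  bound/2 = ≤-trans (/-monoˡ-≤ 2 bound) (≤-reflexive (trans (cong (_/ 2) (*-comm 2 nonEdges)) (m*n/n≡m nonEdges 2)))
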